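{- Let $\Pi = (\mathcal{A}, \mathcal{R})$ be a ground epistemic logic program (ELP). Let $a \in \mathcal{A}$, let $\ell$ be a literal over $a$ (i.e. $\ell = a$ or $\ell = \neg a$) such that the epistemic literal $\mathbf{not}\,\ell$ does not appear in $\mathcal{R}$, and let $r_1$ be the rule $\bot \gets a, \neg a, \mathbf{not}\,\ell$. Let $\Pi' = (\mathcal{A}, \mathcal{R} \cup \{r_1\})$. Then the set of Shen–Eiter candidate world views of $\Pi$ equals the set of Shen–Eiter candidate world views of $\Pi'$.
   Context: A literal over a set of atoms $\mathcal{A}$ is an atom $a\in\mathcal{A}$ or its default negation $\neg a$. A logic program (with double negation) is a pair $(\mathcal{A},\mathcal{R})$ of a set of atoms and rules $a_1\vee\dots\vee a_l \leftarrow a_{l+1},\dots,a_m,\neg\ell_1,\dots,\neg\ell_n$ with $a_i\in\mathcal{A}$ and $\ell_i$ literals (so doubly negated atoms may occur; a head with $l=0$ is written $\bot$). An interpretation $I\subseteq\mathcal{A}$ satisfies $a$ iff $a\in I$, satisfies $\neg \ell$ iff it does not satisfy $\ell$; it is a model of a rule if whenever it satisfies all body elements it contains some head atom; a model of a program is a model of all its rules. The GL-reduct $\Pi^I$ keeps, for each rule all of whose negated body elements $\neg\ell$ are satisfied by $I$, the rule $\mathrm{head}\leftarrow$ (positive body atoms). $M\subseteq\mathcal{A}$ is an answer set of $\Pi$ if $M$ is a model of $\Pi$ and no $M'\subsetneq M$ is a model of $\Pi^M$; $\mathrm{AS}(\Pi)$ denotes the set of answer sets. An epistemic literal is $\mathbf{not}\,\ell$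 for a literal $\ell$. A ground ELP is $\Pi=(\mathcal{A},\mathcal{R})$ with rules $a_1\vee\dots\vee a_k \leftarrow \ell_1,\dots,\ell_m,\xi_1,\dots,\xi_j,\neg\xi_{j+1},\dots,\neg\xi_n$, where $a_i\in\mathcal{A}$, $\ell_i$ are literals and $\xi_i$ epistemic literals over $\mathcal{A}$. Let $\mathrm{elit}(\Pi)$ be the set of epistemic literals occurring in $\Pi$. For an epistemic guess $\Phi\subseteq\mathrm{elit}(\Pi)$, the Shen–Eiter epistemic reduct $\Pi^\Phi$ is obtained by replacing every occurrence of an epistemic literal $\mathbf{not}\,\ell\in\Phi$ by $\top$ and every remaining $\mathbf{not}\,$ by default negation $\neg$ (triple negation $\neg\neg\neg a$ is identified with $\neg a$); it is a logic program. A set $\mathcal{M}$ of interpretations is a Shen–Eiter candidate world view (SE-CWV) of $\Pi$ if there is $\Phi\subseteq\mathrm{elit}(\Pi)$ with $\mathcal{M}=\mathrm{AS}(\Pi^\Phi)$ such that (1) $\mathcal{M}\neq\emptyset$; (2) for each $\mathbf{not}\,\ell\in\Phi$ some $M\in\mathcal{M}$ does not satisfy $\ell$; (3) for each $\mathbf{not}\,\ell\in\mathrm{elit}(\Pi)\setminus\Phi$ every $M\in\mathcal{M}$ satisfies $\ell$. -}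

module Defs where

open import Data.Nat using (ℕ)
open import Data.Fin using (Fin)
open import Data.Bool using (Bool; true; false; not; _∨_; if_then_else_)
open import Data.Vec using (lookup)
open import Data.List using (List; []; _∷_; concatMap)
open import Data.Bool.ListAction using (all; any)
open import Data.List.Relation.Unary.All using (All)
open import Data.List.Relation.Unary.Any using (Any)
open import Data.Fin.Subset using (Subset; _⊂_)
open import Data.Product using (Σ; ∃; _×_)
open import Data.Sum using (_⊎_)
open import Relation.Binary.PropositionalEquality using (_≡_)
open import Relation.Nullary using (¬_)
open import Function.Bundles using (_⇔_)
open import Level using (0ℓ)

data Lit (n : ℕ) : Set where
  pos : Fin n → Lit n
  neg : Fin n → Lit n

-- body elements: positive atom a, negated literal ¬ℓ, and the constants
-- ⊤ and ¬⊤ (which arise from the epistemic reduct)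
data LBody (n : ℕ) : Set where
  batom   : Fin n → LBody n
  bnot    : Lit n → LBody n
  btop    : LBody n
  bnottop : LBody n

record LRule (n : ℕ) : Set where
  constructor lrule
  field
    head : List (Fin n)      -- empty head = ⊥
    body : List (LBody n)
open LRule public

LProgram : ℕ → Set
LProgram n = List (LRule n)

Interp : ℕ → Set
Interp n = Subset n

satLit : ∀ {n} → Interp n → Lit n → Bool
satLit I (pos a) = lookup I a
satLit I (neg a) = not (lookup I a)

satLB : ∀ {n} → Interp n → LBody n → Bool
satLB I (batom a) = lookup I a
satLB I (bnot ℓ)  = not (satLit I ℓ)
satLB I btop      = true
satLB I bnottop   = false

satRule : ∀ {n} → Interp n → LRule n → Bool
satRule I r = not (all (satLB I) (body r)) ∨ any (lookup I) (head r)

IsModel : ∀ {n} → Interp n → LProgram n → Set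
IsModel I P = All (λ r → satRule I r ≡ true) P

isNegated : ∀ {n} → LBody n → Bool
isNegated (batom _) = false
isNegated (bnot _)  = true
isNegated btop      = false
isNegated bnottop   = true

posAtoms : ∀ {n} → List (LBody n) → List (LBody n)
posAtoms = concatMap (λ { (batom a) → batom a ∷ [] ; _ → [] })

glRule : ∀ {n} → Interp n → LRule n → List (LRule n)
glRule I r =
  if all (λ b → not (isNegated b) ∨ satLB I b) (body r)
  then lrule (head r) (posAtoms (body r)) ∷ []
  else []

GL : ∀ {n} → LProgram n → Interp n → LProgram n
GL P I = concatMap (glRule I) P

IsAnswerSet : ∀ {n} → LProgram n → Interp n → Set
IsAnswerSet P M = IsModel M P × (∀ M' → M' ⊂ M → ¬ IsModel M' (GL P M))

data EBody (n : ℕ) : Set where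
  elit : Lit n → EBody n
  ep   : Lit n → EBody n      -- epistemic literal  not ℓ
  nep  : Lit n → EBody n      -- negated epistemic literal  ¬ not ℓ

record ERule (n : ℕ) : Set where
  constructor erule
  field
    ehead : List (Fin n)
    ebody : List (EBody n)
open ERule public

-- ground ELP (𝒜, ℛ) with 𝒜 = Fin n and ℛ a finite list of rules
ELP : ℕ → Set
ELP n = List (ERule n)

InElit : ∀ {n} → Lit n → ELP n → Set
InElit ℓ Π = Any (λ r → Any (λ b → b ≡ ep ℓ ⊎ b ≡ nep ℓ) (ebody r)) Π

-- epistemic guess Φ ⊆ elit(Π), given by its characteristic function on
-- literals (Φ ℓ ≡ true means  not ℓ ∈ Φ)
Guess : ℕ → Set
Guess n = Lit n → Bool

GuessIn : ∀ {n} → Guess n → ELP n → Set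
GuessIn Φ Π = ∀ ℓ → Φ ℓ ≡ true → InElit ℓ Π

-- ¬¬ℓ, with ¬¬¬a identified with ¬a
dneg : ∀ {n} → Lit n → LBody n
dneg (pos a) = bnot (neg a)
dneg (neg a) = bnot (pos a)

reductB : ∀ {n} → Guess n → EBody n → LBody n
reductB Φ (elit (pos a)) = batom a
reductB Φ (elit (neg a)) = bnot (pos a)
reductB Φ (ep ℓ)  = if Φ ℓ then btop else bnot ℓ
reductB Φ (nep ℓ) = if Φ ℓ then bnottop else dneg ℓ

reductR : ∀ {n} → Guess n → ERule n → LRule n
reductR Φ r = lrule (ehead r) (Data.List.map (reductB Φ) (ebody r))

reduct : ∀ {n} → Guess n → ELP n → LProgram n
reduct Φ Π = Data.List.map (reductR Φ) Π

WorldView : ℕ → Set₁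
WorldView n = Interp n → Set

IsSECWV : ∀ {n} → ELP n → WorldView n → Set
IsSECWV {n} Π W =
  Σ (Guess n) λ Φ →
    GuessIn Φ Π
    × (∀ M → W M ⇔ IsAnswerSet (reduct Φ Π) M)
    × (∃ λ M → W M)
    × (∀ ℓ → Φ ℓ ≡ true → ∃ λ M → W M × satLit M ℓ ≡ false)
    × (∀ ℓ → InElit ℓ Π → Φ ℓ ≡ false → ∀ M → W M → satLit M ℓ ≡ true)

-- Under every guess the reduct of r₁ is ⊥ ← a, ¬a, X.  No interpretation
-- satisfies both a and ¬a, and for an M with a ∉ M the GL-reduct of this rule
-- is (at most) ⊥ ← a, …, which every subset of M satisfies; so adding it to a
-- program changes neither its models nor the minimality test, hence not its
-- answer sets.  Since not ℓ does not occur in Π, the guess on not ℓ does not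
-- affect the reduct of Π and may be chosen freely: guess it exactly when some
-- answer set falsifies ℓ (decidable, as answer sets over finitely many atoms
-- are), which settles conditions (2) and (3) for not ℓ.
module Submission where

open import Defs
open import Data.Bool using (Bool; true; false; not; _∨_; if_then_else_)
import Data.Bool as Bool
open import Data.Bool.ListAction using (all)
open import Data.Bool.Properties using (¬-not)
open import Data.Empty using (⊥-elim)
open import Data.Fin using (Fin)
import Data.Fin.Properties as Fin
open import Data.Fin.Subset using (Subset; _⊆_)
open import Data.Fin.Subset.Properties using (_⊂?_; anySubset?)
open import Data.List using (List; []; _∷_)
open import Data.List.Membership.Propositional using (lose)
open import Data.List.Properties using (map-cong-local)
open import Data.List.Relation.Unary.All using ([]; _∷_)
import Data.List.Relation.Unary.All as All
open import Data.List.Relation.Unary.All.Properties using (++⁺; ++⁻ʳ)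
open import Data.List.Relation.Unary.Any using (here; there)
open import Data.Nat using (ℕ)
open import Data.Product using (∃; _×_; _,_; proj₁)
open import Data.Sum using (_⊎_; inj₁; inj₂)
open import Data.Vec using (lookup)
open import Data.Vec.Properties using (lookup⇒[]=; []=⇒lookup)
open import Function using (_∘_)
open import Function.Bundles using (_⇔_; mk⇔; Equivalence)
import Function.Properties.Equivalence as ⇔
open import Relation.Binary.PropositionalEquality using (_≡_; refl; sym; trans; cong; cong₂)
open import Relation.Nullary using (¬_; Dec; yes; no; does)
import Relation.Nullary.Decidable as Dec
open import Relation.Nullary.Decidable using (_×-dec_)

private
  variable
    n : ℕ

_≟ᴸ_ : (x y : Lit n) → Dec (x ≡ y)
pos x ≟ᴸ pos y with x Fin.≟ y
... | yes refl = yes refl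
... | no x≢y   = no λ { refl → x≢y refl }
pos x ≟ᴸ neg y = no λ ()
neg x ≟ᴸ pos y = no λ ()
neg x ≟ᴸ neg y with x Fin.≟ y
... | yes refl = yes refl
... | no x≢y   = no λ { refl → x≢y refl }

lookup-false-⊆ : ∀ {p q : Subset n} {x} → p ⊆ q → lookup q x ≡ false → lookup p x ≡ false
lookup-false-⊆ {p = p} {x = x} p⊆q qx≡false with lookup p x in px≡true
... | false = refl
... | true with () ← trans (sym ([]=⇒lookup (p⊆q (lookup⇒[]= x p px≡true)))) qx≡false

isModel? : ∀ (I : Interp n) P → Dec (IsModel I P)
isModel? I = All.all? (λ r → satRule I r Bool.≟ true)

isAnswerSet? : ∀ (P : LProgram n) M → Dec (IsAnswerSet P M)
isAnswerSet? P M with isModel? M P | anySubset? (λ M' → (M' ⊂? M) ×-dec isModel? M' (GL P M))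
... | no ¬model | _                          = no (¬model ∘ proj₁)
... | yes model | yes (M' , M'⊂M , M'model) = no λ (_ , minimal) → minimal M' M'⊂M M'model
... | yes model | no ¬smaller               = yes (model , λ M' M'⊂M M'model → ¬smaller (M' , M'⊂M , M'model))

IsAnswerSet-cong : ∀ {P Q : LProgram n} {M} → P ≡ Q → IsAnswerSet P M ⇔ IsAnswerSet Q M
IsAnswerSet-cong refl = ⇔.refl

IsAnswerSet-∷-redundant : ∀ {r : LRule n}
  → (∀ I → satRule I r ≡ true)
  → (∀ {M M'} → M' ⊆ M → IsModel M' (glRule M r))
  → ∀ P M → IsAnswerSet (r ∷ P) M ⇔ IsAnswerSet P M
IsAnswerSet-∷-redundant {r = r} sat gl P M = mk⇔ drop add
  where
  drop : IsAnswerSet (r ∷ P) M → IsAnswerSet P M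
  drop (_ ∷ model , minimal) =
    model , λ M' M'⊂M M'model → minimal M' M'⊂M (++⁺ (gl (proj₁ M'⊂M)) M'model)
  add : IsAnswerSet P M → IsAnswerSet (r ∷ P) M
  add (model , minimal) =
    sat M ∷ model , λ M' M'⊂M M'model → minimal M' M'⊂M (++⁻ʳ (glRule M r) M'model)

module _ {a : Fin n} {h : List (Fin n)} where

  satRule-∉-batom : ∀ I bs → lookup I a ≡ false → satRule I (lrule h (batom a ∷ bs)) ≡ true
  satRule-∉-batom I bs Ia≡false rewrite Ia≡false = refl

  satRule-contradictory : ∀ {bs} I → satRule I (lrule h (batom a ∷ bnot (pos a) ∷ bs)) ≡ true
  satRule-contradictory I with lookup I a
  ... | true  = refl
  ... | false = refl

  glRule-contradictory-model : ∀ {bs M M'} → M' ⊆ M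
    → IsModel M' (glRule M (lrule h (batom a ∷ bnot (pos a) ∷ bs)))
  glRule-contradictory-model {bs} {M} {M'} M'⊆M with lookup M a in Ma≡false
  ... | true = []
  ... | false with all (λ b → not (isNegated b) ∨ satLB M b) bs
  ...   | false = []
  ...   | true  = satRule-∉-batom M' (posAtoms bs) (lookup-false-⊆ M'⊆M Ma≡false) ∷ []

  IsAnswerSet-∷-contradictory : ∀ {bs} P M
    → IsAnswerSet (lrule h (batom a ∷ bnot (pos a) ∷ bs) ∷ P) M ⇔ IsAnswerSet P M
  IsAnswerSet-∷-contradictory {bs} =
    IsAnswerSet-∷-redundant (satRule-contradictory {bs}) (glRule-contradictory-model {bs})

reductB-cong : ∀ {Φ Ψ : Guess n} b
  → (∀ ℓ → b ≡ ep ℓ ⊎ b ≡ nep ℓ → Φ ℓ ≡ Ψ ℓ) → reductB Φ b ≡ reductB Ψ b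
reductB-cong (elit (pos _)) _ = refl
reductB-cong (elit (neg _)) _ = refl
reductB-cong (ep ℓ)  agree = cong (if_then btop else bnot ℓ) (agree ℓ (inj₁ refl))
reductB-cong (nep ℓ) agree = cong (if_then bnottop else dneg ℓ) (agree ℓ (inj₂ refl))

reduct-cong : ∀ {Φ Ψ : Guess n} Π → (∀ ℓ → InElit ℓ Π → Φ ℓ ≡ Ψ ℓ) → reduct Φ Π ≡ reduct Ψ Π
reduct-cong []      agree = refl
reduct-cong (r ∷ Π) agree = cong₂ _∷_
  (cong (lrule (ehead r)) (map-cong-local (All.tabulate λ {b} b∈ →
    reductB-cong b λ ℓ b≡ → agree ℓ (here (lose b∈ b≡)))))
  (reduct-cong Π (λ ℓ → agree ℓ ∘ there))

override : Guess n → Lit n → Bool → Guess n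
override Φ ℓ v ℓ' = if does (ℓ' ≟ᴸ ℓ) then v else Φ ℓ'

override-≢ : ∀ (Φ : Guess n) {ℓ ℓ'} v → ¬ ℓ' ≡ ℓ → override Φ ℓ v ℓ' ≡ Φ ℓ'
override-≢ Φ {ℓ} {ℓ'} v ℓ'≢ℓ with ℓ' ≟ᴸ ℓ
... | yes ℓ'≡ℓ = ⊥-elim (ℓ'≢ℓ ℓ'≡ℓ)
... | no _     = refl

reduct-override : ∀ {Π : ELP n} {ℓ} → ¬ InElit ℓ Π → ∀ Φ v → reduct (override Φ ℓ v) Π ≡ reduct Φ Π
reduct-override {Π = Π} ℓ∉Π Φ v =
  reduct-cong Π λ ℓ' ℓ'∈Π → override-≢ Φ v λ { refl → ℓ∉Π ℓ'∈Π }

falsifier? : ∀ {W : WorldView n} {P} → (∀ M → W M ⇔ IsAnswerSet P M)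
  → ∀ ℓ → Dec (∃ λ M → W M × satLit M ℓ ≡ false)
falsifier? {P = P} W≐P ℓ =
  Dec.map′ (λ (M , as , f) → M , Equivalence.from (W≐P M) as , f)
           (λ (M , w , f) → M , Equivalence.to (W≐P M) w , f)
           (anySubset? λ M → isAnswerSet? P M ×-dec (satLit M ℓ Bool.≟ false))

contradictionRule : Fin n → Lit n → ERule n
contradictionRule a ℓ = erule [] (elit (pos a) ∷ elit (neg a) ∷ ep ℓ ∷ [])

module _ (Π : ELP n) (a : Fin n) (ℓ : Lit n) (ℓ∉Π : ¬ InElit ℓ Π) (W : WorldView n) where

  private
    Π' = contradictionRule a ℓ ∷ Π

  InElit-contradictionRule : ∀ {ℓ'} → InElit ℓ' Π' → InElit ℓ' Π ⊎ ℓ' ≡ ℓ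
  InElit-contradictionRule (here (there (there (here (inj₁ refl))))) = inj₂ refl
  InElit-contradictionRule (here (there (there (here (inj₂ ())))))
  InElit-contradictionRule (here (here (inj₁ ())))
  InElit-contradictionRule (here (here (inj₂ ())))
  InElit-contradictionRule (here (there (here (inj₁ ()))))
  InElit-contradictionRule (here (there (here (inj₂ ()))))
  InElit-contradictionRule (there ℓ'∈Π) = inj₁ ℓ'∈Π

  answerSets-contradictionRule : ∀ Φ Ψ → reduct Φ Π ≡ reduct Ψ Π
    → ∀ M → IsAnswerSet (reduct Φ Π) M ⇔ IsAnswerSet (reduct Ψ Π') M
  answerSets-contradictionRule Φ Ψ reducts≡ M =
    ⇔.trans (IsAnswerSet-cong reducts≡) (⇔.sym (IsAnswerSet-∷-contradictory (reduct Ψ Π) M))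

  IsSECWV-extend : (v : Bool)
    → (v ≡ true → ∃ λ M → W M × satLit M ℓ ≡ false)
    → (v ≡ false → ∀ M → W M → satLit M ℓ ≡ true)
    → IsSECWV Π W → IsSECWV Π' W
  IsSECWV-extend v v-falsified v-satisfied (Φ , Φ⊆ , W≐ , nonempty , falsified , satisfied) =
    Ψ , Ψ⊆ , W≐' , nonempty , falsified' , satisfied'
    where
    Ψ = override Φ ℓ v
    W≐' : ∀ M → W M ⇔ IsAnswerSet (reduct Ψ Π') M
    W≐' M = ⇔.trans (W≐ M)
      (answerSets-contradictionRule Φ Ψ (sym (reduct-override ℓ∉Π Φ v)) M)
    Ψ⊆ : GuessIn Ψ Π'
    Ψ⊆ ℓ' Ψℓ' with ℓ' ≟ᴸ ℓ
    ... | yes refl = here (there (there (here (inj₁ refl))))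
    ... | no _     = there (Φ⊆ ℓ' Ψℓ')
    falsified' : ∀ ℓ' → Ψ ℓ' ≡ true → ∃ λ M → W M × satLit M ℓ' ≡ false
    falsified' ℓ' Ψℓ' with ℓ' ≟ᴸ ℓ
    ... | yes refl = v-falsified Ψℓ'
    ... | no _     = falsified ℓ' Ψℓ'
    satisfied' : ∀ ℓ' → InElit ℓ' Π' → Ψ ℓ' ≡ false → ∀ M → W M → satLit M ℓ' ≡ true
    satisfied' ℓ' ℓ'∈Π' Ψℓ' with ℓ' ≟ᴸ ℓ | InElit-contradictionRule ℓ'∈Π'
    ... | yes refl | _           = v-satisfied Ψℓ'
    ... | no ℓ'≢ℓ | inj₂ ℓ'≡ℓ   = ⊥-elim (ℓ'≢ℓ ℓ'≡ℓ)
    ... | no _    | inj₁ ℓ'∈Π   = satisfied ℓ' ℓ'∈Π Ψℓ'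

  IsSECWV-restrict : IsSECWV Π' W → IsSECWV Π W
  IsSECWV-restrict (Ψ , Ψ⊆ , W≐ , nonempty , falsified , satisfied) =
    Φ , Φ⊆ , W≐' , nonempty , falsified' , satisfied'
    where
    Φ = override Ψ ℓ false
    W≐' : ∀ M → W M ⇔ IsAnswerSet (reduct Φ Π) M
    W≐' M = ⇔.trans (W≐ M)
      (⇔.sym (answerSets-contradictionRule Φ Ψ (reduct-override ℓ∉Π Ψ false) M))
    Φ⊆ : GuessIn Φ Π
    Φ⊆ ℓ' Φℓ' with ℓ' ≟ᴸ ℓ
    ... | no ℓ'≢ℓ with InElit-contradictionRule (Ψ⊆ ℓ' Φℓ')
    ...   | inj₁ ℓ'∈Π = ℓ'∈Π
    ...   | inj₂ ℓ'≡ℓ = ⊥-elim (ℓ'≢ℓ ℓ'≡ℓ)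
    Φ⊆ ℓ' () | yes refl
    falsified' : ∀ ℓ' → Φ ℓ' ≡ true → ∃ λ M → W M × satLit M ℓ' ≡ false
    falsified' ℓ' Φℓ' with ℓ' ≟ᴸ ℓ
    ... | no _ = falsified ℓ' Φℓ'
    falsified' ℓ' () | yes refl
    satisfied' : ∀ ℓ' → InElit ℓ' Π → Φ ℓ' ≡ false → ∀ M → W M → satLit M ℓ' ≡ true
    satisfied' ℓ' ℓ'∈Π Φℓ' with ℓ' ≟ᴸ ℓ
    ... | yes refl = ⊥-elim (ℓ∉Π ℓ'∈Π)
    ... | no _     = satisfied ℓ' (there ℓ'∈Π) Φℓ'

  IsSECWV-contradictionRule : IsSECWV Π W ⇔ IsSECWV Π' W
  IsSECWV-contradictionRule = mk⇔ extend IsSECWV-restrict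
    where
    extend : IsSECWV Π W → IsSECWV Π' W
    extend cwv@(_ , _ , W≐ , _) with falsifier? W≐ ℓ
    ... | yes witness = IsSECWV-extend true (λ _ → witness) (λ ()) cwv
    ... | no ¬witness = IsSECWV-extend false (λ ())
                          (λ _ M w → ¬-not λ f → ¬witness (M , w , f)) cwv

lemma1 : ∀ {n} (Π : ELP n) (a : Fin n) (ℓ : Lit n)
         → (ℓ ≡ pos a ⊎ ℓ ≡ neg a)
         → ¬ InElit ℓ Π
         → ∀ (W : WorldView n)
         → IsSECWV Π W ⇔ IsSECWV (erule [] (elit (pos a) ∷ elit (neg a) ∷ ep ℓ ∷ []) ∷ Π) W
lemma1 Π a ℓ _ ℓ∉Π W = IsSECWV-contradictionRule Π a ℓ ℓ∉Π W
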